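{- Let $p$ be a prime and let $m=r_3(\lfloor p/2\rfloor)$. Then there exists a random subset $A\subset[p^2-p]$ (i.e. a probability distribution on subsets of $[p^2-p]$) such that $A$ is always $3$-AP-free (with respect to $\mathbb{Z}$), and such that for every $p$-AP $P\subset[p^2-p]$ (with respect to $\mathbb{Z}$), \[\mathbb{P}(A\cap P=\emptyset)=\Big(1-\frac{m}{p-1}\Big)^m.\] Consequently, if $\big(1-\frac{m}{p-1}\big)^m\le p^{ -3}$, then $w(3,p)>p^2-p$.
   Context: $[n]=\{1,\dots,n\}$. A $k$-AP (with respect to $\mathbb{Z}$) is a set $\{g,g+d,\dots,g+(k-1)d\}\subset\mathbb{Z}$ with $d\neq 0$; a set is $k$-AP-free if it contains no $k$-AP as a subset. For a positive integer $N$, $r_3(N)$ denotes the maximum cardinality of a $3$-AP-free subset of $[N]$. For an integer $k\ge 3$, $w(3,k)$ is the smallest positive integer $N$ such that every blue/red coloring of $[N]$ contains either a blue $3$-AP or a red $k$-AP. -}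

module Defs where

open import Data.Bool using (Bool; true; false; not)
open import Data.Nat using (ℕ; zero; suc; _+_; _*_; _<_; _≤_)
open import Data.Integer using (+_)
open import Data.Rational using (ℚ; _/_; 0ℚ; 1ℚ) renaming (_+_ to _+ℚ_; _*_ to _*ℚ_)
open import Data.Vec using (Vec; []; _∷_)
open import Data.Fin.Subset using (Subset; ∁; ∣_∣)
open import Data.List using (List; []; _∷_; upTo)
open import Data.Product using (_×_; _,_; ∃-syntax; Σ-syntax)
open import Data.Sum using (_⊎_)
open import Relation.Binary.PropositionalEquality using (_≡_)
open import Relation.Nullary using (¬_)

-- A subset of [N] = {1,…,N}: a Bool vector whose head is the membership bit of 1.
-- `memb S x` decides x ∈ S (false for x = 0 and x > N).
memb : {N : ℕ} → Subset N → ℕ → Bool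
memb []      _             = false
memb (b ∷ S) zero          = false
memb (b ∷ S) (suc zero)    = b
memb (b ∷ S) (suc (suc x)) = memb S (suc x)

-- S contains a k-AP {g, g+d, …, g+(k-1)d} (d ≠ 0; w.l.o.g. d > 0 since it is a set)
HasAP : {N : ℕ} → ℕ → Subset N → Set
HasAP k S = ∃[ g ] ∃[ d ] (0 < d × (∀ i → i < k → memb S (g + i * d) ≡ true))

APFree : {N : ℕ} → ℕ → Subset N → Set
APFree k S = ¬ HasAP k S

IsR3 : ℕ → ℕ → Set
IsR3 N m = (Σ[ S ∈ Subset N ] (APFree 3 S × ∣ S ∣ ≡ m))
         × (∀ (S : Subset N) → APFree 3 S → ∣ S ∣ ≤ m)

-- Every blue/red colouring of [N] (blue = true) has a blue 3-AP or a red k-AP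
W3Prop : ℕ → ℕ → Set
W3Prop k N = ∀ (c : Subset N) → HasAP 3 c ⊎ HasAP k (∁ c)

IsW3 : ℕ → ℕ → Set
IsW3 k w = 0 < w × W3Prop k w × (∀ N → 0 < N → N < w → ¬ W3Prop k N)

-- m / n as a rational (junk value 0 when n = 0)
ratio : ℕ → ℕ → ℚ
ratio m zero    = 0ℚ
ratio m (suc n) = (+ m) / suc n

powℚ : ℚ → ℕ → ℚ
powℚ q zero    = 1ℚ
powℚ q (suc n) = q *ℚ powℚ q n

-- A finitely supported probability distribution on subsets of [N]:
-- a list of (outcome, weight) pairs, weights ≥ 0 and summing to 1.
Dist : ℕ → Set
Dist N = List (Subset N × ℚ)

totalWeight : {N : ℕ} → Dist N → ℚ
totalWeight []             = 0ℚ
totalWeight ((_ , w) ∷ xs) = w +ℚ totalWeight xs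

prob : {N : ℕ} → Dist N → (Subset N → Bool) → ℚ
prob [] E = 0ℚ
prob ((S , w) ∷ xs) E with E S
... | true  = w +ℚ prob xs E
... | false = prob xs E

allB : (ℕ → Bool) → List ℕ → Bool
allB f []       = true
allB f (x ∷ xs) with f x
... | true  = allB f xs
... | false = false

disjointAP : {N : ℕ} → ℕ → ℕ → ℕ → Subset N → Bool
disjointAP g d k A = allB (λ i → not (memb A (g + i * d))) (upTo k)

module Submission where

-- Let h = ⌊p/2⌋ and let S₀ ⊆ [h] be 3-AP-free with |S₀| = m. Write x ∈ [p² - p] as x = r + (y - 1) p with
-- 0 ≤ r < p and 1 ≤ y ≤ p - 1, and for v uniform in [p - 1]^h let A_v = {x : r ∈ S₀ and v_r y mod p ∈ S₀}.
-- In a 3-AP inside A_v the residues r lie in S₀ ⊆ [h] with 2h ≤ p, so they form a 3-AP of integers and are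
-- equal; then the rows y form a 3-AP, hence so do the residues of v_r y, which are therefore equal too, and
-- since p is prime the rows coincide: A_v is 3-AP-free. A p-AP in [p² - p] has difference d < p, so it meets
-- every residue class exactly once, say s ∈ S₀ in row y_s, and it misses A_v iff v_s y_s ∉ S₀ for every
-- s ∈ S₀. These are independent events in the coordinates of v, each of probability 1 - m/(p - 1), as
-- v_s ↦ v_s y_s permutes the nonzero residues. Finally [p² - p] contains fewer than p³ p-APs, so when each
-- is missed with probability at most p⁻³ some A_v meets them all; colouring it blue shows w(3,p) > p² - p.

open import Defs
open import Data.Nat using (ℕ)
import Data.Nat as Nat
open import Data.Nat.Primality using (Prime)
open import Data.Fin.Subset using (Subset)
open import Data.Product using (_×_)
open import Data.Bool using (false)
open import Relation.Binary.PropositionalEquality using (_≡_)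

ProgressionIn : ℕ → ℕ → ℕ → ℕ → Set
ProgressionIn N j g d = 1 Nat.≤ g × 0 Nat.< d × g Nat.+ j Nat.* d Nat.≤ N

Blocks : ∀ {N} → ℕ → Subset N → Set
Blocks {N} j S = ∀ g d → ProgressionIn N j g d → disjointAP g d (Nat.suc j) S ≡ false

module BoolLists where

  open import Data.Bool using (Bool; true; false; not; _∧_; _∨_; if_then_else_)
  open import Data.Nat using (ℕ; zero; suc; _+_; _*_; _^_; _<_; z≤n; s≤s; _≡ᵇ_)
  open import Data.Nat.Properties using (+-suc)
  open import Data.Bool.Properties using (∧-zeroʳ; ∧-identityʳ)
  open import Data.Bool.ListAction using (and; all)
  open import Data.List using (List; []; _∷_; applyUpTo; map; length; _++_; cartesianProductWith)
  open import Data.List.Properties using (map-∘; length-++; length-map)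
  open import Data.Vec using (Vec; []; _∷_)
  open import Relation.Binary.PropositionalEquality using (_≡_; refl; sym; trans; cong; cong₂)

  private variable
    A B : Set

  allB≡all : ∀ (p : ℕ → Bool) xs → allB p xs ≡ all p xs
  allB≡all p [] = refl
  allB≡all p (x ∷ xs) with p x
  ... | true  = allB≡all p xs
  ... | false = refl

  all-cong : ∀ {p q : A → Bool} → (∀ x → p x ≡ q x) → ∀ xs → all p xs ≡ all q xs
  all-cong e [] = refl
  all-cong e (x ∷ xs) = cong₂ _∧_ (e x) (all-cong e xs)

  all-true : ∀ (xs : List A) → all (λ _ → true) xs ≡ true
  all-true [] = refl
  all-true (x ∷ xs) = all-true xs

  all-map : ∀ (p : B → Bool) (f : A → B) xs → all p (map f xs) ≡ all (λ x → p (f x)) xs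
  all-map p f xs = cong and (sym (map-∘ xs))

  all-∧ : ∀ (p q : A → Bool) xs → all p xs ∧ all q xs ≡ all (λ x → p x ∧ q x) xs
  all-∧ p q [] = refl
  all-∧ p q (x ∷ xs) with p x | q x
  ... | true  | true  = all-∧ p q xs
  ... | true  | false = ∧-zeroʳ (all p xs)
  ... | false | _     = refl

  all-applyUpTo-cong : ∀ {p : A → Bool} {q : B → Bool} {f : ℕ → A} {g : ℕ → B} n →
    (∀ i → i < n → p (f i) ≡ q (g i)) → all p (applyUpTo f n) ≡ all q (applyUpTo g n)
  all-applyUpTo-cong zero e = refl
  all-applyUpTo-cong (suc n) e = cong₂ _∧_ (e 0 (s≤s z≤n)) (all-applyUpTo-cong n (λ i i<n → e (suc i) (s≤s i<n)))

  all-applyUpTo-unique : ∀ (p g : A → Bool) (f : ℕ → A) n i₀ → i₀ < n →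
    (∀ i → i < n → p (f i) ≡ (i ≡ᵇ i₀)) → all (λ x → not (p x ∧ g x)) (applyUpTo f n) ≡ not (g (f i₀))
  all-applyUpTo-unique p g f (suc n) zero _ unique rewrite unique 0 (s≤s z≤n) =
    trans (cong (not (g (f 0)) ∧_) (trans (all-applyUpTo-cong n misses) (all-true (applyUpTo (λ i → i) n))))
          (∧-identityʳ _)
    where
    misses : ∀ i → i < n → not (p (f (suc i)) ∧ g (f (suc i))) ≡ true
    misses i i<n rewrite unique (suc i) (s≤s i<n) = refl
  all-applyUpTo-unique p g f (suc n) (suc i₀) (s≤s i₀<n) unique rewrite unique 0 (s≤s z≤n) =
    all-applyUpTo-unique p g (λ i → f (suc i)) n i₀ i₀<n (λ i i<n → unique (suc i) (s≤s i<n))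

  count : (A → Bool) → List A → ℕ
  count p [] = 0
  count p (x ∷ xs) = if p x then suc (count p xs) else count p xs

  count-cong : ∀ {p q : A → Bool} → (∀ x → p x ≡ q x) → ∀ xs → count p xs ≡ count q xs
  count-cong e [] = refl
  count-cong {q = q} e (x ∷ xs) rewrite e x with q x
  ... | true  = cong suc (count-cong e xs)
  ... | false = count-cong e xs

  count-false : ∀ (xs : List A) → count (λ _ → false) xs ≡ 0
  count-false [] = refl
  count-false (x ∷ xs) = count-false xs

  count-true : ∀ (xs : List A) → count (λ _ → true) xs ≡ length xs
  count-true [] = refl
  count-true (x ∷ xs) = cong suc (count-true xs)

  count-∨ : ∀ (p q : A → Bool) → (∀ x → p x ∧ q x ≡ false) → ∀ xs →
    count (λ x → p x ∨ q x) xs ≡ count p xs + count q xs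
  count-∨ p q disjoint [] = refl
  count-∨ p q disjoint (x ∷ xs) with p x | q x | disjoint x
  ... | true  | false | _ = cong suc (count-∨ p q disjoint xs)
  ... | false | true  | _ = trans (cong suc (count-∨ p q disjoint xs)) (sym (+-suc _ _))
  ... | false | false | _ = count-∨ p q disjoint xs

  count-not : ∀ (p : A → Bool) xs → count (λ x → not (p x)) xs + count p xs ≡ length xs
  count-not p [] = refl
  count-not p (x ∷ xs) with p x
  ... | true  = trans (+-suc _ _) (cong suc (count-not p xs))
  ... | false = cong suc (count-not p xs)

  count-++ : ∀ (p : A → Bool) xs ys → count p (xs ++ ys) ≡ count p xs + count p ys
  count-++ p [] ys = refl
  count-++ p (x ∷ xs) ys with p x
  ... | true  = cong suc (count-++ p xs ys)
  ... | false = count-++ p xs ys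

  count-map : ∀ (p : B → Bool) (f : A → B) xs → count p (map f xs) ≡ count (λ x → p (f x)) xs
  count-map p f [] = refl
  count-map p f (x ∷ xs) with p (f x)
  ... | true  = cong suc (count-map p f xs)
  ... | false = count-map p f xs

  count-applyUpTo-unique : ∀ (p : A → Bool) (f : ℕ → A) n i₀ → i₀ < n →
    (∀ i → i < n → p (f i) ≡ (i ≡ᵇ i₀)) → count p (applyUpTo f n) ≡ 1
  count-applyUpTo-unique p f (suc n) zero _ unique rewrite unique 0 (s≤s z≤n) =
    cong suc (misses n (λ i i<n → unique (suc i) (s≤s i<n)))
    where
    misses : ∀ {f} n → (∀ i → i < n → p (f i) ≡ false) → count p (applyUpTo f n) ≡ 0
    misses zero _ = refl
    misses (suc n) none rewrite none 0 (s≤s z≤n) = misses n (λ i i<n → none (suc i) (s≤s i<n))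
  count-applyUpTo-unique p f (suc n) (suc i₀) (s≤s i₀<n) unique rewrite unique 0 (s≤s z≤n) =
    count-applyUpTo-unique p (λ i → f (suc i)) n i₀ i₀<n (λ i i<n → unique (suc i) (s≤s i<n))

  vectors : List A → (r : ℕ) → List (Vec A r)
  vectors L zero = [] ∷ []
  vectors L (suc r) = cartesianProductWith _∷_ L (vectors L r)

  allPointwise : ∀ {r} → Vec (A → Bool) r → Vec A r → Bool
  allPointwise [] [] = true
  allPointwise (p ∷ ps) (a ∷ v) = p a ∧ allPointwise ps v

  productOfCounts : ∀ {r} → List A → Vec (A → Bool) r → ℕ
  productOfCounts L [] = 1
  productOfCounts L (p ∷ ps) = count p L * productOfCounts L ps

  count-vectors : ∀ (L : List A) {r} (ps : Vec (A → Bool) r) →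
    count (allPointwise ps) (vectors L r) ≡ productOfCounts L ps
  count-vectors L [] = refl
  count-vectors L {suc r} (p ∷ ps) = trans (split L) (cong (count p L *_) (count-vectors L ps))
    where
    V = vectors L r
    prefixed : ∀ {a b} → p a ≡ b →
      count (allPointwise (p ∷ ps)) (map (a ∷_) V) ≡ count (λ v → b ∧ allPointwise ps v) V
    prefixed {a} pa≡b = trans (count-map _ (a ∷_) V) (count-cong (λ v → cong (_∧ allPointwise ps v) pa≡b) V)
    split : ∀ L′ →
      count (allPointwise (p ∷ ps)) (cartesianProductWith _∷_ L′ V) ≡ count p L′ * count (allPointwise ps) V
    split [] = refl
    split (a ∷ L′) with p a in pa≡b
    ... | true  = trans (count-++ _ (map (a ∷_) V) _) (cong₂ _+_ (prefixed pa≡b) (split L′))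
    ... | false = trans (count-++ _ (map (a ∷_) V) _) (cong₂ _+_ (trans (prefixed pa≡b) (count-false V)) (split L′))

  length-cartesianProductWith : ∀ {B C : Set} (f : A → B → C) xs ys →
    length (cartesianProductWith f xs ys) ≡ length xs * length ys
  length-cartesianProductWith f [] ys = refl
  length-cartesianProductWith f (x ∷ xs) ys = trans (length-++ (map (f x) ys))
    (cong₂ _+_ (length-map (f x) ys) (length-cartesianProductWith f xs ys))

  length-vectors : ∀ (L : List A) r → length (vectors L r) ≡ length L ^ r
  length-vectors L zero = refl
  length-vectors L (suc r) = trans (length-cartesianProductWith _∷_ L (vectors L r)) (cong (length L *_) (length-vectors L r))

module Weights where

  open import Data.Bool using (Bool; true; false)
  open import Data.Nat as ℕ using (zero; suc)
  open import Data.Integer as ℤ using (ℤ; +[1+_])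
  open import Data.Integer.Tactic.RingSolver using (solve-∀)
  open import Data.Nat using (ℕ)
  open import Data.Rational as ℚ using (ℚ; 0ℚ; 1ℚ; toℚᵘ; _+_; _-_; _*_; _≤_; _<_; nonNegative)
  open import Data.Rational.Properties
  open import Data.Rational.Unnormalised as ℚᵘ using (mkℚᵘ; *≡*; *≤*; *<*)
  import Data.Rational.Unnormalised.Properties as ℚᵘ
  import Data.Integer.Properties as ℤ
  open import Algebra.Bundles using (CommutativeRing)
  open import Algebra.Properties.Semiring.Mult (CommutativeRing.semiring +-*-commutativeRing)
    using (×-assocˡ; ×-assoc-*; ×-comm-*)
  open import Algebra.Properties.Semiring.Mult (CommutativeRing.semiring +-*-commutativeRing)
    using () renaming (_×_ to _·_) public
  open import Data.List using (List; []; _∷_; map; length)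
  open import Data.Product using (_,_)
  open import Data.Fin.Subset using (Subset)
  open import Relation.Binary.PropositionalEquality using (_≡_; refl; sym; trans; cong; subst; subst₂; module ≡-Reasoning)
  open BoolLists using (count)

  private
    toℚᵘ-ratio : ∀ a n → toℚᵘ (ratio a (suc n)) ℚᵘ.≃ mkℚᵘ (ℤ.+ a) n
    toℚᵘ-ratio a n = toℚᵘ-fromℚᵘ (mkℚᵘ (ℤ.+ a) n)

    common-denominator : ∀ (a b s : ℤ) → (a ℤ.* s ℤ.+ b ℤ.* s) ℤ.* s ≡ (a ℤ.+ b) ℤ.* (s ℤ.* s)
    common-denominator = solve-∀

  ratio-+ : ∀ a b n → ratio a (suc n) + ratio b (suc n) ≡ ratio (a ℕ.+ b) (suc n)
  ratio-+ a b n = toℚᵘ-injective (ℚᵘ.≃-trans (toℚᵘ-homo-+ (ratio a (suc n)) (ratio b (suc n)))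
    (ℚᵘ.≃-trans (ℚᵘ.+-cong (toℚᵘ-ratio a n) (toℚᵘ-ratio b n))
    (ℚᵘ.≃-trans (*≡* (common-denominator (ℤ.+ a) (ℤ.+ b) +[1+ n ])) (ℚᵘ.≃-sym (toℚᵘ-ratio (a ℕ.+ b) n)))))

  ratio-self : ∀ n → ratio (suc n) (suc n) ≡ 1ℚ
  ratio-self n = toℚᵘ-injective (ℚᵘ.≃-trans (toℚᵘ-ratio (suc n) n) (*≡* (ℤ.*-comm (ℤ.+ suc n) (ℤ.+ 1))))

  ratio-nonneg : ∀ a n → 0ℚ ≤ ratio a (suc n)
  ratio-nonneg a n = toℚᵘ-cancel-≤ (ℚᵘ.≤-respʳ-≃ (ℚᵘ.≃-sym (toℚᵘ-ratio a n))
    (*≤* (subst (ℤ._≤_ (ℤ.+ 0)) (sym (ℤ.*-identityʳ (ℤ.+ a))) (ℤ.+≤+ ℕ.z≤n))))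

  ratio<1 : ∀ a n → a ℕ.< suc n → ratio a (suc n) < 1ℚ
  ratio<1 a n a<n = toℚᵘ-cancel-< (ℚᵘ.<-respˡ-≃ (ℚᵘ.≃-sym (toℚᵘ-ratio a n))
    (*<* (subst₂ ℤ._<_ (sym (ℤ.*-identityʳ (ℤ.+ a))) (sym (ℤ.*-identityˡ (ℤ.+ suc n))) (ℤ.+<+ a<n))))

  ·-ratio : ∀ a n → a · ratio 1 (suc n) ≡ ratio a (suc n)
  ·-ratio zero n = sym (0/n≡0 (suc n))
  ·-ratio (suc a) n = trans (cong (ratio 1 (suc n) +_) (·-ratio a n)) (ratio-+ 1 a n)

  ratio-complement : ∀ c m n → c ℕ.+ m ≡ suc n → ratio c (suc n) ≡ 1ℚ - ratio m (suc n)
  ratio-complement c m n c+m≡n = begin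
    γ                  ≡⟨ sym (+-identityʳ γ) ⟩
    γ + 0ℚ             ≡⟨ cong (γ +_) (sym (+-inverseʳ μ)) ⟩
    γ + (μ - μ)        ≡⟨ sym (+-assoc γ μ (ℚ.- μ)) ⟩
    (γ + μ) - μ        ≡⟨ cong (_- μ) (ratio-+ c m n) ⟩
    ratio (c ℕ.+ m) (suc n) - μ ≡⟨ cong (λ x → ratio x (suc n) - μ) c+m≡n ⟩
    ratio (suc n) (suc n) - μ   ≡⟨ cong (_- μ) (ratio-self n) ⟩
    1ℚ - μ             ∎
    where
    open ≡-Reasoning
    γ = ratio c (suc n)
    μ = ratio m (suc n)

  ·-*-interchange : ∀ a b x y → (a ℕ.* b) · (x * y) ≡ (a · x) * (b · y)
  ·-*-interchange a b x y = begin
    (a ℕ.* b) · (x * y) ≡⟨ sym (×-assocˡ (x * y) a b) ⟩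
    a · (b · (x * y))   ≡⟨ cong (a ·_) (sym (×-comm-* b x y)) ⟩
    a · (x * (b · y))   ≡⟨ sym (×-assoc-* a x (b · y)) ⟩
    (a · x) * (b · y)   ∎
    where open ≡-Reasoning

  ^-·-powℚ : ∀ a x r → (a ℕ.^ r) · powℚ x r ≡ powℚ (a · x) r
  ^-·-powℚ a x zero = +-identityʳ 1ℚ
  ^-·-powℚ a x (suc r) = trans (·-*-interchange a (a ℕ.^ r) x (powℚ x r)) (cong ((a · x) *_) (^-·-powℚ a x r))

  powℚ-one : ∀ r → powℚ 1ℚ r ≡ 1ℚ
  powℚ-one zero = refl
  powℚ-one (suc r) = trans (*-identityˡ (powℚ 1ℚ r)) (powℚ-one r)

  powℚ-nonneg : ∀ {x} r → 0ℚ ≤ x → 0ℚ ≤ powℚ x r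
  powℚ-nonneg zero _ = ratio-nonneg 1 0
  powℚ-nonneg {x} (suc r) 0≤x = nonNegative⁻¹ (x * powℚ x r)
    {{nonNeg*nonNeg⇒nonNeg x {{nonNegative 0≤x}} (powℚ x r) {{nonNegative (powℚ-nonneg r 0≤x)}}}}

  module _ {N : ℕ} {A : Set} (outcome : A → Subset N) (w : ℚ) where

    equallyWeighted : List A → Dist N
    equallyWeighted = map (λ x → outcome x , w)

    prob-equallyWeighted : ∀ E xs → prob (equallyWeighted xs) E ≡ count (λ x → E (outcome x)) xs · w
    prob-equallyWeighted E [] = refl
    prob-equallyWeighted E (x ∷ xs) with E (outcome x)
    ... | true  = cong (w +_) (prob-equallyWeighted E xs)
    ... | false = prob-equallyWeighted E xs

    totalWeight-equallyWeighted : ∀ xs → totalWeight (equallyWeighted xs) ≡ length xs · w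
    totalWeight-equallyWeighted [] = refl
    totalWeight-equallyWeighted (x ∷ xs) = cong (w +_) (totalWeight-equallyWeighted xs)

module Residues where

  open import Data.Nat
  open import Data.Nat.Properties
  open import Data.Nat.DivMod
  open import Data.Nat.Divisibility using (_∣_; divides; >⇒∤)
  open import Data.Nat.Primality using (Prime; euclidsLemma; prime⇒nonZero)
  open import Data.Nat.Tactic.RingSolver using (solve-∀)
  open import Data.Fin as Fin using (Fin; toℕ; fromℕ<; punchOut)
  open import Data.Fin.Properties using (any?; punchOut-injective; injective⇒≤; toℕ<n; toℕ-fromℕ<; toℕ-injective)
  open import Data.Product using (∃; _×_; _,_)
  open import Data.Sum using (inj₁; inj₂)
  open import Function.Definitions using (Injective)
  open import Relation.Nullary using (yes; no; contradiction)
  open import Relation.Nullary.Decidable using (dec-true; dec-false)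
  open import Relation.Binary.PropositionalEquality

  injective⇒surjective : ∀ {n} (f : Fin n → Fin n) → Injective _≡_ _≡_ f → ∀ t → ∃ λ i → f i ≡ t
  injective⇒surjective {suc n} f f-injective t with any? (λ i → f i Fin.≟ t)
  ... | yes hit = hit
  ... | no miss = contradiction (injective⇒≤ punched-injective) (n≮n n)
    where
    punched : Fin (suc n) → Fin n
    punched i = punchOut {i = t} {j = f i} (λ t≡fi → miss (i , sym t≡fi))
    punched-injective : Injective _≡_ _≡_ punched
    punched-injective {i} {j} eq =
      f-injective (punchOut-injective {i = t} (λ t≡fi → miss (i , sym t≡fi)) (λ t≡fj → miss (j , sym t≡fj)) eq)

  %-≡⇒∣∸ : ∀ a b n .{{_ : NonZero n}} → a % n ≡ b % n → n ∣ b ∸ a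
  %-≡⇒∣∸ a b n eq = divides (b / n ∸ a / n) (begin
    b ∸ a                                         ≡⟨ cong₂ _∸_ (m≡m%n+[m/n]*n b n) (m≡m%n+[m/n]*n a n) ⟩
    (b % n + (b / n) * n) ∸ (a % n + (a / n) * n) ≡⟨ cong (λ r → (b % n + (b / n) * n) ∸ (r + (a / n) * n)) eq ⟩
    (b % n + (b / n) * n) ∸ (b % n + (a / n) * n) ≡⟨ [m+n]∸[m+o]≡n∸o (b % n) _ _ ⟩
    (b / n) * n ∸ (a / n) * n                     ≡⟨ sym (*-distribʳ-∸ n (b / n) (a / n)) ⟩
    (b / n ∸ a / n) * n                           ∎)
    where open ≡-Reasoning

  %-injective-on-[1,n] : ∀ {x y n} .{{_ : NonZero n}} →
    1 ≤ x → x ≤ n → 1 ≤ y → y ≤ n → x % n ≡ y % n → x ≡ y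
  %-injective-on-[1,n] {x} {y} {n} 1≤x x≤n 1≤y y≤n eq with m≤n⇒m<n∨m≡n x≤n | m≤n⇒m<n∨m≡n y≤n
  ... | inj₁ x<n | inj₁ y<n = trans (sym (m<n⇒m%n≡m x<n)) (trans eq (m<n⇒m%n≡m y<n))
  ... | inj₁ x<n | inj₂ refl = contradiction (trans (sym (m<n⇒m%n≡m x<n)) (trans eq (n%n≡0 n))) (≢-sym (<⇒≢ 1≤x))
  ... | inj₂ refl | inj₁ y<n = contradiction (trans (sym (n%n≡0 n)) (trans eq (m<n⇒m%n≡m y<n))) (<⇒≢ 1≤y)
  ... | inj₂ refl | inj₂ refl = refl

  %-pos⇒/-< : ∀ {x m n} .{{_ : NonZero n}} → 1 ≤ x % n → x ≤ m * n → x / n < m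
  %-pos⇒/-< {x} {m} {n} 1≤x%n x≤m*n = *-cancelʳ-< n (x / n) m (<-≤-trans [x/n]*n<x x≤m*n)
    where
    [x/n]*n<x : (x / n) * n < x
    [x/n]*n<x = subst ((x / n) * n <_) (sym (m≡m%n+[m/n]*n x n)) (m<n+m ((x / n) * n) 1≤x%n)

  m%n≡r⇒m≡r+[m/n]*n : ∀ {m r n} .{{_ : NonZero n}} → m % n ≡ r → m ≡ r + (m / n) * n
  m%n≡r⇒m≡r+[m/n]*n {m} {r} {n} m%n≡r = trans (m≡m%n+[m/n]*n m n) (cong (_+ (m / n) * n) m%n≡r)

  %-≡⇒/-AP : ∀ {x y z n} .{{_ : NonZero n}} → x % n ≡ y % n → z % n ≡ y % n →
             x + z ≡ y + y → x / n + z / n ≡ y / n + y / n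
  %-≡⇒/-AP {x} {y} {z} {n} x≡y z≡y x+z≡y+y =
    *-cancelʳ-≡ (x / n + z / n) (y / n + y / n) n (+-cancelˡ-≡ (r + r) _ _ (begin
      (r + r) + (x / n + z / n) * n         ≡⟨ regroup r (x / n) (z / n) n ⟩
      (r + (x / n) * n) + (r + (z / n) * n) ≡⟨ cong₂ _+_ (sym (m%n≡r⇒m≡r+[m/n]*n x≡y)) (sym (m%n≡r⇒m≡r+[m/n]*n z≡y)) ⟩
      x + z                                 ≡⟨ x+z≡y+y ⟩
      y + y                                 ≡⟨ cong₂ _+_ (m≡m%n+[m/n]*n y n) (m≡m%n+[m/n]*n y n) ⟩
      (r + (y / n) * n) + (r + (y / n) * n) ≡⟨ sym (regroup r (y / n) (y / n) n) ⟩
      (r + r) + (y / n + y / n) * n         ∎))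
    where
    open ≡-Reasoning
    r = y % n
    regroup : ∀ r a b n → (r + r) + (a + b) * n ≡ (r + a * n) + (r + b * n)
    regroup = solve-∀

  module AffineMaps {p : ℕ} (p-prime : Prime p) where

    private instance
      p≢0 : NonZero p
      p≢0 = prime⇒nonZero p-prime

    private
      affine-injective-≤ : ∀ e {c a b} → 0 < c → c < p → b < p → a ≤ b →
                           (e + a * c) % p ≡ (e + b * c) % p → a ≡ b
      affine-injective-≤ e {c} {a} {b} 0<c c<p b<p a≤b eq
        with euclidsLemma (b ∸ a) c p-prime p∣[b∸a]*c
        where
        p∣[b∸a]*c : p ∣ (b ∸ a) * c
        p∣[b∸a]*c = subst (p ∣_) (trans ([m+n]∸[m+o]≡n∸o e (b * c) (a * c)) (sym (*-distribʳ-∸ c b a)))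
                          (%-≡⇒∣∸ (e + a * c) (e + b * c) p eq)
      ... | inj₂ p∣c = contradiction p∣c (>⇒∤ {{≢-nonZero (≢-sym (<⇒≢ 0<c))}} c<p)
      ... | inj₁ p∣b∸a with b ∸ a in b∸a≡
      ...   | zero   = ≤-antisym a≤b (m∸n≡0⇒m≤n b∸a≡)
      ...   | suc d  = contradiction p∣b∸a (>⇒∤ (subst (_< p) b∸a≡ (≤-<-trans (m∸n≤m b a) b<p)))

    affine-injective : ∀ e {c a b} → 0 < c → c < p → a < p → b < p →
                       (e + a * c) % p ≡ (e + b * c) % p → a ≡ b
    affine-injective e {a = a} {b} 0<c c<p a<p b<p eq with ≤-total a b
    ... | inj₁ a≤b = affine-injective-≤ e 0<c c<p b<p a≤b eq
    ... | inj₂ b≤a = sym (affine-injective-≤ e 0<c c<p a<p b≤a (sym eq))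

    affine-≡ᵇ : ∀ e {c i i₀ t} → 0 < c → c < p → i < p → i₀ < p → (e + i₀ * c) % p ≡ t →
                ((e + i * c) % p ≡ᵇ t) ≡ (i ≡ᵇ i₀)
    affine-≡ᵇ e {i = i} {i₀} {t} 0<c c<p i<p i₀<p hit with i ≟ i₀
    ... | yes refl = trans (dec-true (_ ≟ t) hit) (sym (dec-true (i ≟ i) refl))
    ... | no i≢i₀  = trans (dec-false (_ ≟ t) (λ eq → i≢i₀ (affine-injective e 0<c c<p i<p i₀<p (trans eq (sym hit)))))
                           (sym (dec-false (i ≟ i₀) i≢i₀))

    affine-surjective : ∀ e {c t} → 0 < c → c < p → t < p → ∃ λ a → a < p × (e + a * c) % p ≡ t
    affine-surjective e {c} {t} 0<c c<p t<p with injective⇒surjective f f-injective (fromℕ< t<p)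
      where
      f : Fin p → Fin p
      f i = fromℕ< (m%n<n (e + toℕ i * c) p)
      f-injective : Injective _≡_ _≡_ f
      f-injective {i} {j} eq = toℕ-injective (affine-injective e 0<c c<p (toℕ<n i) (toℕ<n j)
        (trans (sym (toℕ-fromℕ< _)) (trans (cong toℕ eq) (toℕ-fromℕ< _))))
    ... | i , fi≡t = toℕ i , toℕ<n i , trans (sym (toℕ-fromℕ< _)) (trans (cong toℕ fi≡t) (toℕ-fromℕ< t<p))

module Subsets where

  open import Data.Bool using (Bool; true; false; _∧_; _∨_)
  open import Data.Bool.Properties using (∧-zeroʳ; ∧-identityʳ)
  open import Data.Nat
  open import Data.Nat.Properties
  open import Data.Nat.Tactic.RingSolver using (solve-∀)
  open import Data.Fin.Subset using (Subset; ∁; ∣_∣)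
  open import Data.List using (List)
  open import Data.Vec using ([]; _∷_)
  open import Data.Product using (_×_; _,_; proj₂)
  open import Relation.Nullary using (yes; no; contradiction)
  open import Relation.Binary.Definitions using (tri<; tri≈; tri>)
  open import Relation.Binary.PropositionalEquality
  open BoolLists using (count; count-cong; count-∨; count-false)

  private variable
    N : ℕ

  memb-0 : (S : Subset N) → memb S 0 ≡ false
  memb-0 [] = refl
  memb-0 (b ∷ S) = refl

  memb-range : (S : Subset N) → ∀ {x} → memb S x ≡ true → 1 ≤ x × x ≤ N
  memb-range (b ∷ S) {suc zero} _ = s≤s z≤n , s≤s z≤n
  memb-range (b ∷ S) {suc (suc x)} x∈S = s≤s z≤n , s≤s (proj₂ (memb-range S x∈S))

  memb-∷ : ∀ b (S : Subset N) x → memb (b ∷ S) x ≡ ((x ≡ᵇ 1) ∧ b) ∨ memb S (pred x)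
  memb-∷ b S zero = sym (memb-0 S)
  memb-∷ true S (suc zero) = refl
  memb-∷ false S (suc zero) = sym (memb-0 S)
  memb-∷ b S (suc (suc x)) = refl

  memb-∁ : (S : Subset N) → ∀ {x} → memb (∁ S) x ≡ true → memb S x ≡ false
  memb-∁ (false ∷ S) {suc zero} _ = refl
  memb-∁ (b ∷ S) {suc (suc x)} x∈∁S = memb-∁ S x∈∁S

  subsetOf : (N : ℕ) → (ℕ → Bool) → Subset N
  subsetOf zero f = []
  subsetOf (suc N) f = f 1 ∷ subsetOf N (λ x → f (suc x))

  memb-subsetOf : ∀ N f {x} → 1 ≤ x → x ≤ N → memb (subsetOf N f) x ≡ f x
  memb-subsetOf (suc N) f {suc zero} _ _ = refl
  memb-subsetOf (suc N) f {suc (suc x)} _ (s≤s x<N) = memb-subsetOf N (λ y → f (suc y)) (s≤s z≤n) x<N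

  memb-subsetOf⁻ : ∀ N f {x} → memb (subsetOf N f) x ≡ true → f x ≡ true
  memb-subsetOf⁻ N f x∈S = let (1≤x , x≤N) = memb-range (subsetOf N f) x∈S in
    trans (sym (memb-subsetOf N f 1≤x x≤N)) x∈S

  count-memb : ∀ {A : Set} (L : List A) (φ : A → ℕ) (S : Subset N) →
    (∀ s → 1 ≤ s → s ≤ N → count (λ a → φ a ≡ᵇ s) L ≡ 1) → count (λ a → memb S (φ a)) L ≡ ∣ S ∣
  count-memb L φ [] _ = count-false L
  count-memb {suc N} L φ (b ∷ S) unique = begin
    count (λ a → memb (b ∷ S) (φ a)) L
      ≡⟨ count-cong (λ a → memb-∷ b S (φ a)) L ⟩
    count (λ a → ((φ a ≡ᵇ 1) ∧ b) ∨ memb S (pred (φ a))) L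
      ≡⟨ count-∨ (λ a → (φ a ≡ᵇ 1) ∧ b) (λ a → memb S (pred (φ a))) disjoint L ⟩
    count (λ a → (φ a ≡ᵇ 1) ∧ b) L + count (λ a → memb S (pred (φ a))) L
      ≡⟨ cong (count (λ a → (φ a ≡ᵇ 1) ∧ b) L +_) (count-memb L (λ a → pred (φ a)) S unique′) ⟩
    count (λ a → (φ a ≡ᵇ 1) ∧ b) L + ∣ S ∣
      ≡⟨ head b ⟩
    ∣ b ∷ S ∣ ∎
    where
    open ≡-Reasoning
    disjoint : ∀ a → ((φ a ≡ᵇ 1) ∧ b) ∧ memb S (pred (φ a)) ≡ false
    disjoint a with φ a
    ... | zero = refl
    ... | suc zero rewrite memb-0 S = ∧-zeroʳ b
    ... | suc (suc x) = refl
    unique′ : ∀ s → 1 ≤ s → s ≤ N → count (λ a → pred (φ a) ≡ᵇ s) L ≡ 1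
    unique′ (suc s) _ s<N = trans (count-cong shift L) (unique (suc (suc s)) (s≤s z≤n) (s≤s s<N))
      where
      shift : ∀ a → (pred (φ a) ≡ᵇ suc s) ≡ (φ a ≡ᵇ suc (suc s))
      shift a with φ a
      ... | zero = refl
      ... | suc x = refl
    head : ∀ b → count (λ a → (φ a ≡ᵇ 1) ∧ b) L + ∣ S ∣ ≡ ∣ b ∷ S ∣
    head true  = cong (_+ ∣ S ∣) (trans (count-cong (λ a → ∧-identityʳ (φ a ≡ᵇ 1)) L) (unique 1 (s≤s z≤n) (s≤s z≤n)))
    head false = cong (_+ ∣ S ∣) (trans (count-cong (λ a → ∧-zeroʳ (φ a ≡ᵇ 1)) L) (count-false L))

  private
    APFree3⇒no-ascending : (S : Subset N) → APFree 3 S → ∀ {a b c} → a < b →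
      memb S a ≡ true → memb S b ≡ true → memb S c ≡ true → a + c ≢ b + b
    APFree3⇒no-ascending S free {a} {b} {c} a<b a∈S b∈S c∈S a+c≡b+b = free (a , d , m<n⇒0<n∸m a<b , term)
      where
      d = b ∸ a
      a+d≡b : a + d ≡ b
      a+d≡b = m+[n∸m]≡n (<⇒≤ a<b)
      double : ∀ a d → (a + d) + (a + d) ≡ a + (a + 2 * d)
      double = solve-∀
      a+2d≡c : a + 2 * d ≡ c
      a+2d≡c = sym (+-cancelˡ-≡ a c (a + 2 * d)
        (trans a+c≡b+b (trans (cong₂ _+_ (sym a+d≡b) (sym a+d≡b)) (double a d))))
      term : ∀ i → i < 3 → memb S (a + i * d) ≡ true
      term 0 _ = subst (λ x → memb S x ≡ true) (sym (+-identityʳ a)) a∈S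
      term 1 _ = subst (λ x → memb S x ≡ true) (trans (sym a+d≡b) (cong (a +_) (sym (*-identityˡ d)))) b∈S
      term 2 _ = subst (λ x → memb S x ≡ true) (sym a+2d≡c) c∈S
      term (suc (suc (suc _))) (s≤s (s≤s (s≤s ())))

  APFree3⇒midpoint : (S : Subset N) → APFree 3 S → ∀ {a b c} →
    memb S a ≡ true → memb S b ≡ true → memb S c ≡ true → a + c ≡ b + b → a ≡ b
  APFree3⇒midpoint S free {a} {b} {c} a∈S b∈S c∈S a+c≡b+b with <-cmp a b
  ... | tri< a<b _ _ = contradiction a+c≡b+b (APFree3⇒no-ascending S free a<b a∈S b∈S c∈S)
  ... | tri≈ _ a≡b _ = a≡b
  ... | tri> _ _ b<a with c <? b
  ...   | yes c<b = contradiction (trans (+-comm c a) a+c≡b+b) (APFree3⇒no-ascending S free c<b c∈S b∈S a∈S)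
  ...   | no c≮b = contradiction (sym a+c≡b+b) (<⇒≢ (+-mono-<-≤ b<a (≮⇒≥ c≮b)))

module UnionBound where

  open import Data.Bool using (Bool; true; false; if_then_else_; _∧_; _≟_)
  open import Data.Bool.ListAction using (any)
  open import Data.Nat as ℕ using (suc; z≤n; s≤s)
  import Data.Nat.Properties as ℕ
  open import Data.Rational using (ℚ; 0ℚ; 1ℚ; _+_; _≤_; _<_)
  open import Data.Rational.Properties
    using (≤-refl; ≤-trans; ≤-reflexive; ≤-<-trans; <-irrefl; +-mono-≤; +-monoʳ-≤; +-identityˡ; +-identityʳ;
           +-0-commutativeMonoid)
  open import Data.List using (List; []; _∷_; length; map; applyUpTo; cartesianProduct)
  open import Data.List.Properties using (length-map; length-applyUpTo)
  open import Data.List.Membership.Propositional using (_∈_; find)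
  open import Data.List.Membership.Propositional.Properties
    using (∈-map⁺; ∈-map⁻; ∈-cartesianProduct⁺; ∈-cartesianProduct⁻; ∈-applyUpTo⁺; ∈-applyUpTo⁻)
  open import Data.List.Relation.Unary.All as All using (All; []; _∷_)
  open import Data.List.Relation.Unary.All.Properties.Core using (¬All⇒Any¬)
  open import Data.List.Relation.Unary.Any using (here; there)
  open import Data.Fin.Subset using (Subset)
  open import Data.Product using (∃; _×_; _,_; proj₁; proj₂)
  open import Relation.Nullary using (Dec; yes; no; does; contradiction)
  open import Relation.Nullary.Decidable using (dec-true)
  open import Function using (case_of_)
  open import Relation.Binary.PropositionalEquality
  open import Algebra.Bundles using (CommutativeMonoid)
  open import Algebra.Properties.CommutativeSemigroup
    (CommutativeMonoid.commutativeSemigroup +-0-commutativeMonoid) using (interchange)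
  open Weights using (_·_)
  open BoolLists using (length-cartesianProductWith)

  private variable
    A : Set

  sumℚ : (A → ℚ) → List A → ℚ
  sumℚ f [] = 0ℚ
  sumℚ f (x ∷ xs) = f x + sumℚ f xs

  sumℚ-cong : ∀ {f g : A → ℚ} → (∀ x → f x ≡ g x) → ∀ xs → sumℚ f xs ≡ sumℚ g xs
  sumℚ-cong f≗g [] = refl
  sumℚ-cong f≗g (x ∷ xs) = cong₂ _+_ (f≗g x) (sumℚ-cong f≗g xs)

  sumℚ-+ : ∀ (f g : A → ℚ) xs → sumℚ (λ x → f x + g x) xs ≡ sumℚ f xs + sumℚ g xs
  sumℚ-+ f g [] = sym (+-identityˡ 0ℚ)
  sumℚ-+ f g (x ∷ xs) = trans (cong ((f x + g x) +_) (sumℚ-+ f g xs)) (interchange (f x) (g x) (sumℚ f xs) (sumℚ g xs))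

  sumℚ-nonneg : ∀ (f : A → ℚ) → (∀ x → 0ℚ ≤ f x) → ∀ xs → 0ℚ ≤ sumℚ f xs
  sumℚ-nonneg f nonneg [] = ≤-refl
  sumℚ-nonneg f nonneg (x ∷ xs) = +-mono-≤ (nonneg x) (sumℚ-nonneg f nonneg xs)

  sumℚ-≤-length· : ∀ (f : A → ℚ) b xs → All (λ x → f x ≤ b) xs → sumℚ f xs ≤ length xs · b
  sumℚ-≤-length· f b [] [] = ≤-refl
  sumℚ-≤-length· f b (x ∷ xs) (fx≤b ∷ rest) = +-mono-≤ fx≤b (sumℚ-≤-length· f b xs rest)

  prob-∷ : ∀ {N} (S : Subset N) w D E → prob ((S , w) ∷ D) E ≡ (if E S then w else 0ℚ) + prob D E
  prob-∷ S w D E with E S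
  ... | true  = refl
  ... | false = sym (+-identityˡ _)

  private
    weight≤sum-indicators : ∀ {N} {S : Subset N} {w} → 0ℚ ≤ w → ∀ (Es : List (Subset N → Bool)) →
      any (λ E → E S) Es ≡ true → w ≤ sumℚ (λ E → if E S then w else 0ℚ) Es
    weight≤sum-indicators {S = S} {w} 0≤w (E ∷ Es) hit with E S
    ... | true  = ≤-trans (≤-reflexive (sym (+-identityʳ w)))
                    (+-monoʳ-≤ w (sumℚ-nonneg (λ E → if E S then w else 0ℚ) (λ E → indicator-nonneg (E S)) Es))
      where
      indicator-nonneg : ∀ b → 0ℚ ≤ (if b then w else 0ℚ)
      indicator-nonneg true  = 0≤w
      indicator-nonneg false = ≤-refl
    ... | false = ≤-trans (weight≤sum-indicators 0≤w Es hit) (≤-reflexive (sym (+-identityˡ _)))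

  totalWeight≤sumℚ-prob : ∀ {N} (D : Dist N) (Es : List (Subset N → Bool)) →
    All (λ x → 0ℚ ≤ proj₂ x) D → All (λ x → any (λ E → E (proj₁ x)) Es ≡ true) D →
    totalWeight D ≤ sumℚ (prob D) Es
  totalWeight≤sumℚ-prob [] Es [] [] = sumℚ-nonneg (prob []) (λ _ → ≤-refl) Es
  totalWeight≤sumℚ-prob ((S , w) ∷ D) Es (0≤w ∷ nonneg) (hit ∷ hits) =
    ≤-trans (+-mono-≤ (weight≤sum-indicators 0≤w Es hit) (totalWeight≤sumℚ-prob D Es nonneg hits))
            (≤-reflexive (trans (sym (sumℚ-+ (λ E → if E S then w else 0ℚ) (prob D) Es))
                                (sumℚ-cong (λ E → sym (prob-∷ S w D E)) Es)))

  prob-∧ : ∀ {N} (D : Dist N) c (E : Subset N → Bool) → prob D (λ S → c ∧ E S) ≡ (if c then prob D E else 0ℚ)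
  prob-∧ D true E = refl
  prob-∧ [] false E = refl
  prob-∧ (x ∷ D) false E = prob-∧ D false E

  any-∈ : ∀ (f : A → Bool) {x xs} → x ∈ xs → f x ≡ true → any f xs ≡ true
  any-∈ f (here refl) fx≡true rewrite fx≡true = refl
  any-∈ f {xs = y ∷ xs} (there x∈xs) fx≡true with f y
  ... | true  = refl
  ... | false = any-∈ f x∈xs fx≡true

  module APs (j : ℕ) {N : ℕ} (M : ℕ) where

    missesAP : ℕ × ℕ → Subset N → Bool
    missesAP e S = does (proj₁ e ℕ.+ j ℕ.* proj₂ e ℕ.≤? N) ∧ disjointAP (proj₁ e) (proj₂ e) (suc j) S

    candidates : List (ℕ × ℕ)
    candidates = cartesianProduct (applyUpTo suc N) (applyUpTo suc M)

    events : List (Subset N → Bool)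
    events = map missesAP candidates

    candidate-∈ : ∀ g d → ProgressionIn N j g d → d ℕ.≤ M → (g , d) ∈ candidates
    candidate-∈ (suc g) (suc d) (_ , _ , last≤N) d≤M =
      ∈-cartesianProduct⁺ (∈-applyUpTo⁺ suc (ℕ.≤-trans (ℕ.m≤m+n (suc g) (j ℕ.* suc d)) last≤N))
                          (∈-applyUpTo⁺ suc d≤M)

    length-events : length events ≡ N ℕ.* M
    length-events = trans (length-map missesAP candidates)
      (trans (length-cartesianProductWith _,_ (applyUpTo suc N) (applyUpTo suc M))
             (cong₂ ℕ._*_ (length-applyUpTo suc N) (length-applyUpTo suc M)))

    module _ (D : Dist N) {b : ℚ} (0≤b : 0ℚ ≤ b)
             (miss≤b : ∀ g d → ProgressionIn N j g d → prob D (disjointAP g d (suc j)) ≤ b) where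

      private
        prob-missesAP≤ : ∀ g d → g ∈ applyUpTo suc N × d ∈ applyUpTo suc M → prob D (missesAP (g , d)) ≤ b
        prob-missesAP≤ g d (g∈ , d∈) =
          ≤-trans (≤-reflexive (prob-∧ D _ (disjointAP g d (suc j)))) (guarded (g ℕ.+ j ℕ.* d ℕ.≤? N))
          where
          guarded : (in-range? : Dec (g ℕ.+ j ℕ.* d ℕ.≤ N)) →
                    (if does in-range? then prob D (disjointAP g d (suc j)) else 0ℚ) ≤ b
          guarded (no _) = 0≤b
          guarded (yes last≤N) with ∈-applyUpTo⁻ suc g∈ | ∈-applyUpTo⁻ suc d∈
          ... | _ , _ , refl | _ , _ , refl = miss≤b g d (s≤s z≤n , s≤s z≤n , last≤N)

        prob-events≤ : All (λ E → prob D E ≤ b) events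
        prob-events≤ = All.tabulate λ E∈events → case ∈-map⁻ missesAP E∈events of λ where
          ((g , d) , e∈ , refl) → prob-missesAP≤ g d (∈-cartesianProduct⁻ (applyUpTo suc N) (applyUpTo suc M) e∈)

      blocking-outcome : All (λ x → 0ℚ ≤ proj₂ x) D → totalWeight D ≡ 1ℚ →
        (∀ g d → ProgressionIn N j g d → d ℕ.≤ M) → (N ℕ.* M) · b < 1ℚ →
        ∃ λ x → x ∈ D × Blocks j (proj₁ x)
      blocking-outcome nonneg total d≤M N*M·b<1 with All.all? (λ x → any (λ E → E (proj₁ x)) events ≟ true) D
      ... | yes all-hit = contradiction (≤-<-trans one≤ N*M·b<1) (<-irrefl refl)
        where
        one≤ : 1ℚ ≤ (N ℕ.* M) · b
        one≤ = ≤-trans (≤-reflexive (sym total)) (≤-trans (totalWeight≤sumℚ-prob D events nonneg all-hit)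
                 (≤-trans (sumℚ-≤-length· (prob D) b events prob-events≤) (≤-reflexive (cong (_· b) length-events))))
      ... | no ¬all-hit with find (¬All⇒Any¬ (λ x → any (λ E → E (proj₁ x)) events ≟ true) D ¬all-hit)
      ...   | x , x∈D , no-hit = x , x∈D , blocks
        where
        blocks : Blocks j (proj₁ x)
        blocks g d in-range with disjointAP g d (suc j) (proj₁ x) in missed
        ... | false = refl
        ... | true = contradiction (any-∈ (λ E → E (proj₁ x)) (∈-map⁺ missesAP (candidate-∈ g d in-range (d≤M g d in-range))) event)
                                   no-hit
          where
          event : missesAP (g , d) (proj₁ x) ≡ true
          event = trans (cong (_∧ disjointAP g d (suc j) (proj₁ x)) (dec-true (_ ℕ.≤? N) (proj₂ (proj₂ in-range)))) missed

module Colourings where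

  open import Data.Bool using (true; false; not)
  open import Data.Nat
  open import Data.Nat.Properties
  open import Data.Fin.Subset using (∁)
  open import Data.List using (upTo)
  open import Data.Product using (_,_; proj₁; proj₂)
  open import Data.Sum using (inj₁; inj₂)
  open import Relation.Nullary using (¬_; contradiction)
  open import Relation.Binary.PropositionalEquality
  open BoolLists using (allB≡all; all-applyUpTo-cong; all-true)
  open Subsets

  blocking-set⇒¬W3Prop : ∀ {j N w} (S : Subset N) → APFree 3 S → Blocks j S → w ≤ N → ¬ W3Prop (suc j) w
  blocking-set⇒¬W3Prop {j} {N} {w} S S-free blocks w≤N W3 with W3 (subsetOf w (memb S))
  ... | inj₁ (g , d , 0<d , blue) = S-free (g , d , 0<d , λ i i<3 → memb-subsetOf⁻ w (memb S) (blue i i<3))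
  ... | inj₂ (g , d , 0<d , red) = contradiction (trans (sym disjoint) (blocks g d (1≤g , 0<d , last≤N))) (λ ())
    where
    c = subsetOf w (memb S)
    in-[1,w] : ∀ i → i < suc j → 1 ≤ g + i * d × g + i * d ≤ w
    in-[1,w] i i≤j = memb-range (∁ c) (red i i≤j)
    outside : ∀ i → i < suc j → memb S (g + i * d) ≡ false
    outside i i≤j = let (1≤x , x≤w) = in-[1,w] i i≤j in
      trans (sym (memb-subsetOf w (memb S) 1≤x x≤w)) (memb-∁ c (red i i≤j))
    1≤g : 1 ≤ g
    1≤g = subst (1 ≤_) (+-identityʳ g) (proj₁ (in-[1,w] 0 (s≤s z≤n)))
    last≤N : g + j * d ≤ N
    last≤N = ≤-trans (proj₂ (in-[1,w] j (n<1+n j))) w≤N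
    disjoint : disjointAP g d (suc j) S ≡ true
    disjoint = trans (allB≡all (λ i → not (memb S (g + i * d))) (upTo (suc j)))
      (trans (all-applyUpTo-cong {q = λ _ → true} {f = λ i → i} {g = λ i → i} (suc j) (λ i i≤j → cong not (outside i i≤j)))
             (all-true (upTo (suc j))))

  blocking-set⇒<w : ∀ {j N w} (S : Subset N) → APFree 3 S → Blocks j S → IsW3 (suc j) w → N < w
  blocking-set⇒<w S S-free blocks (_ , W3 , _) = ≰⇒> (λ w≤N → blocking-set⇒¬W3Prop S S-free blocks w≤N W3)

module Construction (k : ℕ) (p-prime : Prime (Nat.suc (Nat.suc k))) {h : ℕ} (2h≤p : h Nat.+ h Nat.≤ Nat.suc (Nat.suc k))
                    (S₀ : Subset h) (S₀-free : APFree 3 S₀) where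

  open import Data.Bool using (Bool; true; false; not; _∧_)
  open import Data.Bool.Properties using (∧-identityʳ; ∧-zeroʳ; ∧-conicalˡ; ∧-conicalʳ)
  open import Data.Rational as ℚ using (ℚ; 0ℚ; 1ℚ)
  import Data.Rational.Properties as ℚ
  open import Data.Nat
  open import Data.Nat.Properties
  open import Data.Nat.DivMod
  open import Data.Nat.Tactic.RingSolver using (solve-∀)
  open import Data.Fin.Subset using (∣_∣)
  open import Data.Vec using (Vec; []; _∷_)
  open import Data.List using (List; _∷_; []; applyUpTo; upTo; map; length)
  open import Data.List.Properties using (length-applyUpTo)
  open import Data.List.Membership.Propositional using (_∈_)
  open import Data.List.Membership.Propositional.Properties using (∈-applyUpTo⁻)
  open import Data.List.Relation.Unary.All as All using (All; []; _∷_)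
  open import Data.List.Relation.Unary.All.Properties using (map⁺; cartesianProductWith⁺)
  open import Data.Bool.ListAction using (all)
  open import Data.Product using (∃; _×_; _,_; proj₁; proj₂)
  open import Data.Sum using (_⊎_; inj₁; inj₂)
  open import Relation.Nullary using (contradiction)
  open import Relation.Binary.PropositionalEquality
  open BoolLists
  open Weights
  open Subsets
  open Residues
  open AffineMaps p-prime

  p : ℕ
  p = suc (suc k)

  N : ℕ
  N = p * p ∸ p

  N≡[p-1]*p : N ≡ suc k * p
  N≡[p-1]*p = m+n∸m≡n p (suc k * p)

  inS₀ : ℕ → Bool
  inS₀ t = memb S₀ (t % p)

  -- coord v s is the s-th entry of v (counting from 1, like memb), and 0 when there is none.
  coord : ∀ {r} → Vec ℕ r → ℕ → ℕ
  coord [] _ = 0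
  coord (a ∷ v) zero = 0
  coord (a ∷ v) (suc zero) = a
  coord (a ∷ v) (suc (suc s)) = coord v (suc s)

  row : ℕ → ℕ
  row x = x / p + 1

  inA : Vec ℕ h → ℕ → Bool
  inA v x = inS₀ x ∧ inS₀ (coord v (x % p) * row x)

  A : Vec ℕ h → Subset N
  A v = subsetOf N (inA v)

  UnitEntries : ∀ {r} → Vec ℕ r → Set
  UnitEntries v = ∀ s → coord v s ≡ 0 ⊎ (0 < coord v s × coord v s < p)

  [1,h]<p : ∀ {s} → 1 ≤ s → s ≤ h → s < p
  [1,h]<p 1≤s s≤h = <-≤-trans (m<m+n _ 1≤s) (≤-trans (+-mono-≤ s≤h s≤h) 2h≤p)

  S₀<p : ∀ {s} → memb S₀ s ≡ true → s < p
  S₀<p s∈S₀ = let (1≤s , s≤h) = memb-range S₀ s∈S₀ in [1,h]<p 1≤s s≤h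

  row<p : ∀ {x} → inS₀ x ≡ true → x ≤ N → row x < p
  row<p {x} x∈S₀ x≤N = subst (_< p) (+-comm 1 (x / p))
    (s≤s (%-pos⇒/-< (proj₁ (memb-range S₀ x∈S₀)) (subst (x ≤_) N≡[p-1]*p x≤N)))

  -- Since S₀ ⊆ [1, h] and 2h ≤ p, a 3-AP of residues in S₀ is a 3-AP in ℤ, hence constant.
  residues-of-3AP : ∀ {u₀ u₁ u₂} → inS₀ u₀ ≡ true → inS₀ u₁ ≡ true → inS₀ u₂ ≡ true →
    u₀ + u₂ ≡ u₁ + u₁ → u₀ % p ≡ u₁ % p × u₂ % p ≡ u₁ % p
  residues-of-3AP {u₀} {u₁} {u₂} u₀∈ u₁∈ u₂∈ u₀+u₂≡2u₁ =
    a≡b , +-cancelˡ-≡ a c b (trans a+c≡b+b (cong (_+ b) (sym a≡b)))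
    where
    a = u₀ % p
    b = u₁ % p
    c = u₂ % p
    sum-in-[1,p] : ∀ {x y} → memb S₀ x ≡ true → memb S₀ y ≡ true → 1 ≤ x + y × x + y ≤ p
    sum-in-[1,p] {x} {y} x∈ y∈ = let (1≤x , x≤h) = memb-range S₀ x∈ ; (_ , y≤h) = memb-range S₀ y∈ in
      ≤-trans 1≤x (m≤m+n x y) , ≤-trans (+-mono-≤ x≤h y≤h) 2h≤p
    a+c≡b+b : a + c ≡ b + b
    a+c≡b+b = %-injective-on-[1,n] (proj₁ (sum-in-[1,p] u₀∈ u₂∈)) (proj₂ (sum-in-[1,p] u₀∈ u₂∈))
                                   (proj₁ (sum-in-[1,p] u₁∈ u₁∈)) (proj₂ (sum-in-[1,p] u₁∈ u₁∈))
      (trans (sym (%-distribˡ-+ u₀ u₂ p)) (trans (cong (_% p) u₀+u₂≡2u₁) (%-distribˡ-+ u₁ u₁ p)))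
    a≡b : a ≡ b
    a≡b = APFree3⇒midpoint S₀ S₀-free u₀∈ u₁∈ u₂∈ a+c≡b+b

  equal-residue-and-row : ∀ v → UnitEntries v → ∀ {x₀ x₁ x₂} →
    inA v x₀ ≡ true → inA v x₁ ≡ true → inA v x₂ ≡ true → x₀ ≤ N → x₁ ≤ N → x₀ + x₂ ≡ x₁ + x₁ →
    x₀ % p ≡ x₁ % p × x₀ / p ≡ x₁ / p
  equal-residue-and-row v unit-entries {x₀} {x₁} {x₂} x₀∈ x₁∈ x₂∈ x₀≤N x₁≤N x₀+x₂≡x₁+x₁ =
    proj₁ residues , +-cancelʳ-≡ 1 (x₀ / p) (x₁ / p) rows
    where
    residues = residues-of-3AP {x₀} {x₁} {x₂} (∧-conicalˡ _ _ x₀∈) (∧-conicalˡ _ _ x₁∈) (∧-conicalˡ _ _ x₂∈)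
                 x₀+x₂≡x₁+x₁
    c = coord v (x₁ % p)
    image∈S₀ : ∀ {x} → inA v x ≡ true → x % p ≡ x₁ % p → inS₀ (c * row x) ≡ true
    image∈S₀ {x} x∈ same = subst (λ r → inS₀ (coord v r * row x) ≡ true) same (∧-conicalʳ _ _ x∈)
    scaled-AP : ∀ c a b e → a + b ≡ e + e → c * (a + 1) + c * (b + 1) ≡ c * (e + 1) + c * (e + 1)
    scaled-AP c a b e a+b≡e+e =
      trans (distribute c a b) (trans (cong (λ t → c * t + c * 2) a+b≡e+e) (sym (distribute c e e)))
      where
      distribute : ∀ c a b → c * (a + 1) + c * (b + 1) ≡ c * (a + b) + c * 2
      distribute = solve-∀
    images = residues-of-3AP {c * row x₀} {c * row x₁} {c * row x₂}
      (image∈S₀ {x₀} x₀∈ (proj₁ residues)) (image∈S₀ {x₁} x₁∈ refl) (image∈S₀ {x₂} x₂∈ (proj₂ residues))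
      (scaled-AP c (x₀ / p) (x₂ / p) (x₁ / p) (%-≡⇒/-AP {x₀} {x₁} {x₂} (proj₁ residues) (proj₂ residues) x₀+x₂≡x₁+x₁))
    c-unit : 0 < c × c < p
    c-unit with unit-entries (x₁ % p)
    ... | inj₂ unit = unit
    ... | inj₁ c≡0 = contradiction
      (trans (sym (image∈S₀ {x₁} x₁∈ refl)) (trans (cong (λ t → inS₀ (t * row x₁)) c≡0) (memb-0 S₀))) (λ ())
    rows : row x₀ ≡ row x₁
    rows = affine-injective 0 (proj₁ c-unit) (proj₂ c-unit)
      (row<p {x₀} (∧-conicalˡ _ _ x₀∈) x₀≤N) (row<p {x₁} (∧-conicalˡ _ _ x₁∈) x₁≤N)
      (trans (cong (_% p) (*-comm (row x₀) c)) (trans (proj₁ images) (cong (_% p) (*-comm c (row x₁)))))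

  A-free : ∀ v → UnitEntries v → APFree 3 (A v)
  A-free v unit-entries (g , d , 0<d , x∈A) = <⇒≢ x₀<x₁ x₀≡x₁
    where
    x∈ : ∀ i → i < 3 → inA v (g + i * d) ≡ true
    x∈ i i<3 = memb-subsetOf⁻ N (inA v) (x∈A i i<3)
    x≤N : ∀ i → i < 3 → g + i * d ≤ N
    x≤N i i<3 = proj₂ (memb-range (A v) (x∈A i i<3))
    x-AP : ∀ g d → (g + 0 * d) + (g + 2 * d) ≡ (g + 1 * d) + (g + 1 * d)
    x-AP = solve-∀
    same = equal-residue-and-row v unit-entries (x∈ 0 (s≤s z≤n)) (x∈ 1 (s≤s (s≤s z≤n))) (x∈ 2 (s≤s (s≤s (s≤s z≤n))))
                                 (x≤N 0 (s≤s z≤n)) (x≤N 1 (s≤s (s≤s z≤n))) (x-AP g d)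
    x₀≡x₁ : g + 0 * d ≡ g + 1 * d
    x₀≡x₁ = trans (m≡m%n+[m/n]*n (g + 0 * d) p)
              (trans (cong₂ (λ r q → r + q * p) (proj₁ same) (proj₂ same)) (sym (m≡m%n+[m/n]*n (g + 1 * d) p)))
    x₀<x₁ : g + 0 * d < g + 1 * d
    x₀<x₁ = +-monoʳ-< g (subst (0 <_) (sym (*-identityˡ d)) 0<d)

  units : List ℕ
  units = applyUpTo suc (suc k)

  point : ℕ → ℕ × ℕ
  point x = x % p , row x

  pointsOf : ℕ → ℕ → List (ℕ × ℕ)
  pointsOf g d = applyUpTo (λ i → point (g + i * d)) p

  avoids : ∀ {r} → Subset r → Vec ℕ r → ℕ × ℕ → Bool
  avoids B v e = not (memb B (proj₁ e) ∧ inS₀ (coord v (proj₁ e) * proj₂ e))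

  disjointAP≡all-avoids : ∀ v {g d} → 1 ≤ g → g + (p ∸ 1) * d ≤ N →
    disjointAP g d p (A v) ≡ all (avoids S₀ v) (pointsOf g d)
  disjointAP≡all-avoids v {g} {d} 1≤g last≤N = trans (allB≡all (λ i → not (memb (A v) (g + i * d))) (upTo p))
    (all-applyUpTo-cong {q = avoids S₀ v} {f = λ i → i} {g = λ i → point (g + i * d)} p in-range)
    where
    in-range : ∀ i → i < p → not (memb (A v) (g + i * d)) ≡ avoids S₀ v (point (g + i * d))
    in-range i i<p = cong not (memb-subsetOf N (inA v) (≤-trans 1≤g (m≤m+n g (i * d)))
                                 (≤-trans (+-monoʳ-≤ g (*-monoˡ-≤ d (≤-pred i<p))) last≤N))

  shift : ℕ × ℕ → ℕ × ℕ
  shift e = pred (proj₁ e) , proj₂ e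

  -- Splits the event  all (avoids B v) zs  into independent conditions on the coordinates of v.
  test : Bool → List (ℕ × ℕ) → ℕ → Bool
  test b zs a = all (λ e → not ((proj₁ e ≡ᵇ 1) ∧ (b ∧ inS₀ (a * proj₂ e)))) zs

  tests : ∀ {r} → Subset r → List (ℕ × ℕ) → Vec (ℕ → Bool) r
  tests [] zs = []
  tests (b ∷ B) zs = test b zs ∷ tests B (map shift zs)

  allPointwise-tests : ∀ {r} (B : Subset r) zs v → allPointwise (tests B zs) v ≡ all (avoids B v) zs
  allPointwise-tests [] zs [] = sym (all-true zs)
  allPointwise-tests (b ∷ B) zs (a ∷ v) = begin
    test b zs a ∧ allPointwise (tests B (map shift zs)) v
      ≡⟨ cong (test b zs a ∧_) (trans (allPointwise-tests B (map shift zs) v) (all-map (avoids B v) shift zs)) ⟩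
    all first zs ∧ all (λ e → avoids B v (shift e)) zs
      ≡⟨ all-∧ first (λ e → avoids B v (shift e)) zs ⟩
    all (λ e → first e ∧ avoids B v (shift e)) zs
      ≡⟨ all-cong (λ e → split (proj₁ e) (proj₂ e)) zs ⟩
    all (avoids (b ∷ B) (a ∷ v)) zs ∎
    where
    open ≡-Reasoning
    first : ℕ × ℕ → Bool
    first e = not ((proj₁ e ≡ᵇ 1) ∧ (b ∧ inS₀ (a * proj₂ e)))
    split : ∀ r y → first (r , y) ∧ avoids B v (pred r , y) ≡ avoids (b ∷ B) (a ∷ v) (r , y)
    split zero y rewrite memb-0 B = refl
    split (suc zero) y rewrite memb-0 B = ∧-identityʳ _
    split (suc (suc r)) y = refl

  -- The clause for all F says that s occurs exactly once as a residue in zs, namely with row y.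
  OccursOnce : ∀ {r} → Subset r → List (ℕ × ℕ) → Set
  OccursOnce B zs = ∀ s → memb B s ≡ true → ∃ λ y → (0 < y × y < p) ×
    (∀ (F : ℕ → Bool) → all (λ e → not ((proj₁ e ≡ᵇ s) ∧ F (proj₂ e))) zs ≡ not (F y))

  OccursOnce-shift : ∀ {r} b (B : Subset r) zs → OccursOnce (b ∷ B) zs → OccursOnce B (map shift zs)
  OccursOnce-shift b B zs once zero 0∈B = contradiction (trans (sym (memb-0 B)) 0∈B) (λ ())
  OccursOnce-shift b B zs once (suc s) s∈B with once (suc (suc s)) s∈B
  ... | y , y-unit , unique = y , y-unit , λ F → trans (all-map _ shift zs) (trans (all-cong (shifted F) zs) (unique F))
    where
    shifted : ∀ F e →
      not ((pred (proj₁ e) ≡ᵇ suc s) ∧ F (proj₂ e)) ≡ not ((proj₁ e ≡ᵇ suc (suc s)) ∧ F (proj₂ e))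
    shifted F (zero , _) = refl
    shifted F (suc r , _) = refl

  d<p : ∀ {g d} → 1 ≤ g → g + (p ∸ 1) * d ≤ N → d < p
  d<p {g} {d} 1≤g last≤N = *-cancelˡ-< (suc k) d p
    (<-≤-trans (m<n+m (suc k * d) 1≤g) (subst (g + suc k * d ≤_) N≡[p-1]*p last≤N))

  pointsOf-OccursOnce : ∀ {g d} → 1 ≤ g → 0 < d → g + (p ∸ 1) * d ≤ N → OccursOnce S₀ (pointsOf g d)
  pointsOf-OccursOnce {g} {d} 1≤g 0<d last≤N s s∈S₀
    with affine-surjective g 0<d (d<p 1≤g last≤N) (S₀<p s∈S₀)
  ... | i₀ , i₀<p , hit = row x , (m≤n+m 1 (x / p) , row<p x∈S₀ x≤N) , λ F →
        all-applyUpTo-unique (λ e → proj₁ e ≡ᵇ s) (λ e → F (proj₂ e)) (λ i → point (g + i * d)) p i₀ i₀<p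
          (λ i i<p → affine-≡ᵇ g 0<d (d<p 1≤g last≤N) i<p i₀<p hit)
    where
    x = g + i₀ * d
    x∈S₀ : inS₀ x ≡ true
    x∈S₀ = trans (cong (memb S₀) hit) s∈S₀
    x≤N : x ≤ N
    x≤N = ≤-trans (+-monoʳ-≤ g (*-monoˡ-≤ d (≤-pred i₀<p))) last≤N

  length-units : length units ≡ suc k
  length-units = length-applyUpTo suc (suc k)

  count-inS₀ : ∀ {y} → 0 < y → y < p → count (λ a → inS₀ (a * y)) units ≡ ∣ S₀ ∣
  count-inS₀ {y} 0<y y<p = count-memb units (λ a → (a * y) % p) S₀ hit-once
    where
    hit-once : ∀ s → 1 ≤ s → s ≤ h → count (λ a → (a * y) % p ≡ᵇ s) units ≡ 1
    hit-once s 1≤s s≤h with affine-surjective 0 0<y y<p ([1,h]<p 1≤s s≤h)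
    ... | zero , _ , 0≡s = contradiction (sym 0≡s) (≢-sym (<⇒≢ 1≤s))
    ... | suc j , s≤s j<p-1 , hit = count-applyUpTo-unique _ suc (suc k) j j<p-1
          (λ i i<p-1 → affine-≡ᵇ 0 0<y y<p (s≤s i<p-1) (s≤s j<p-1) hit)

  1/[p-1] : ℚ
  1/[p-1] = ratio 1 (suc k)

  q : ℚ
  q = 1ℚ ℚ.- ratio ∣ S₀ ∣ (suc k)

  units·1/[p-1] : length units · 1/[p-1] ≡ 1ℚ
  units·1/[p-1] = trans (cong (_· 1/[p-1]) length-units) (trans (·-ratio (suc k) k) (ratio-self k))

  member-test-weight : ∀ {y} → 0 < y → y < p → count (λ a → not (inS₀ (a * y))) units · 1/[p-1] ≡ q
  member-test-weight {y} 0<y y<p = trans (·-ratio c k) (ratio-complement c ∣ S₀ ∣ k (begin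
    c + ∣ S₀ ∣
      ≡⟨ cong (c +_) (sym (count-inS₀ 0<y y<p)) ⟩
    c + count (λ a → inS₀ (a * y)) units
      ≡⟨ count-not (λ a → inS₀ (a * y)) units ⟩
    length units
      ≡⟨ length-units ⟩
    suc k ∎))
    where
    open ≡-Reasoning
    c = count (λ a → not (inS₀ (a * y))) units

  productOfCounts-tests : ∀ {r} (B : Subset r) zs → OccursOnce B zs →
    productOfCounts units (tests B zs) · powℚ 1/[p-1] r ≡ powℚ q ∣ B ∣
  productOfCounts-tests [] zs _ = ℚ.+-identityʳ 1ℚ
  productOfCounts-tests {suc r} (b ∷ B) zs once = begin
    (count first units * rest) · (1/[p-1] ℚ.* powℚ 1/[p-1] r)
      ≡⟨ ·-*-interchange (count first units) rest 1/[p-1] (powℚ 1/[p-1] r) ⟩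
    (count first units · 1/[p-1]) ℚ.* (rest · powℚ 1/[p-1] r)
      ≡⟨ cong ((count first units · 1/[p-1]) ℚ.*_) (productOfCounts-tests B (map shift zs) (OccursOnce-shift b B zs once)) ⟩
    (count first units · 1/[p-1]) ℚ.* powℚ q ∣ B ∣
      ≡⟨ first-factor b once ⟩
    powℚ q ∣ b ∷ B ∣ ∎
    where
    open ≡-Reasoning
    first = test b zs
    rest = productOfCounts units (tests B (map shift zs))
    first-factor : ∀ b → OccursOnce (b ∷ B) zs →
      (count (test b zs) units · 1/[p-1]) ℚ.* powℚ q ∣ B ∣ ≡ powℚ q ∣ b ∷ B ∣
    first-factor true once with once 1 refl
    ... | y , (0<y , y<p) , unique = cong (ℚ._* powℚ q ∣ B ∣)
      (trans (cong (_· 1/[p-1]) (count-cong (λ a → unique (λ t → inS₀ (a * t))) units)) (member-test-weight 0<y y<p))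
    first-factor false _ = trans
      (cong (ℚ._* powℚ q ∣ B ∣) (trans (cong (_· 1/[p-1]) (trans (count-cong passes units) (count-true units))) units·1/[p-1]))
                         (ℚ.*-identityˡ _)
      where
      passes : ∀ a → all (λ e → not ((proj₁ e ≡ᵇ 1) ∧ false)) zs ≡ true
      passes a = trans (all-cong (λ e → cong not (∧-zeroʳ (proj₁ e ≡ᵇ 1))) zs) (all-true zs)

  UnitEntries-∷ : ∀ {r a} {v : Vec ℕ r} → 0 < a × a < p → UnitEntries v → UnitEntries (a ∷ v)
  UnitEntries-∷ a-unit v-units zero = inj₁ refl
  UnitEntries-∷ a-unit v-units (suc zero) = inj₂ a-unit
  UnitEntries-∷ a-unit v-units (suc (suc s)) = v-units (suc s)

  vectors-UnitEntries : ∀ r → All UnitEntries (vectors units r)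
  vectors-UnitEntries zero = (λ _ → inj₁ refl) ∷ []
  vectors-UnitEntries (suc r) = cartesianProductWith⁺ (setoid ℕ) (setoid (Vec ℕ r)) _∷_ units (vectors units r)
    λ a∈units v∈vectors → UnitEntries-∷ (unit a∈units) (All.lookup (vectors-UnitEntries r) v∈vectors)
    where
    unit : ∀ {a} → a ∈ units → 0 < a × a < p
    unit a∈units with ∈-applyUpTo⁻ suc a∈units
    ... | i , i<p-1 , refl = s≤s z≤n , s≤s i<p-1

  D : Dist N
  D = equallyWeighted A (powℚ 1/[p-1] h) (vectors units h)

  D-nonneg : All (λ x → 0ℚ ℚ.≤ proj₂ x) D
  D-nonneg = map⁺ (All.universal (λ _ → powℚ-nonneg h (ratio-nonneg 1 k)) (vectors units h))

  D-total : totalWeight D ≡ 1ℚ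
  D-total = begin
    totalWeight D
      ≡⟨ totalWeight-equallyWeighted A (powℚ 1/[p-1] h) (vectors units h) ⟩
    length (vectors units h) · powℚ 1/[p-1] h
      ≡⟨ cong (_· powℚ 1/[p-1] h) (trans (length-vectors units h) (cong (_^ h) length-units)) ⟩
    (suc k ^ h) · powℚ 1/[p-1] h
      ≡⟨ ^-·-powℚ (suc k) 1/[p-1] h ⟩
    powℚ (suc k · 1/[p-1]) h
      ≡⟨ cong (λ x → powℚ x h) (trans (cong (_· 1/[p-1]) (sym length-units)) units·1/[p-1]) ⟩
    powℚ 1ℚ h
      ≡⟨ powℚ-one h ⟩
    1ℚ ∎
    where open ≡-Reasoning

  D-free : All (λ x → APFree 3 (proj₁ x)) D
  D-free = map⁺ (All.map (λ {v} → A-free v) (vectors-UnitEntries h))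

  D-prob : ∀ g d → 1 ≤ g → 0 < d → g + (p ∸ 1) * d ≤ N → prob D (disjointAP g d p) ≡ powℚ q ∣ S₀ ∣
  D-prob g d 1≤g 0<d last≤N = begin
    prob D (disjointAP g d p)
      ≡⟨ prob-equallyWeighted A (powℚ 1/[p-1] h) (disjointAP g d p) (vectors units h) ⟩
    count (λ v → disjointAP g d p (A v)) (vectors units h) · powℚ 1/[p-1] h
      ≡⟨ cong (_· powℚ 1/[p-1] h) (count-cong (λ v → trans (disjointAP≡all-avoids v 1≤g last≤N)
                                                      (sym (allPointwise-tests S₀ (pointsOf g d) v))) (vectors units h)) ⟩
    count (allPointwise (tests S₀ (pointsOf g d))) (vectors units h) · powℚ 1/[p-1] h
      ≡⟨ cong (_· powℚ 1/[p-1] h) (count-vectors units (tests S₀ (pointsOf g d))) ⟩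
    productOfCounts units (tests S₀ (pointsOf g d)) · powℚ 1/[p-1] h
      ≡⟨ productOfCounts-tests S₀ (pointsOf g d) (pointsOf-OccursOnce 1≤g 0<d last≤N) ⟩
    powℚ q ∣ S₀ ∣ ∎
    where open ≡-Reasoning

  N*[p-1]<p³ : N * suc k < p ^ 3
  N*[p-1]<p³ = subst₂ _<_ (cong (_* suc k) (sym N≡[p-1]*p)) (cube p)
    (*-mono-< (*-monoˡ-< p (n<1+n (suc k))) (n<1+n (suc k)))
    where
    cube : ∀ a → a * a * a ≡ a * (a * (a * 1))
    cube = solve-∀

  N<w3 : powℚ q ∣ S₀ ∣ ℚ.≤ ratio 1 (p ^ 3) → ∀ w → IsW3 p w → N < w
  N<w3 q^m≤p⁻³ w W3
    with blocking-outcome D (ratio-nonneg 1 (pred (p ^ 3))) miss≤p⁻³ D-nonneg D-total d≤p-1 few-progressions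
    where
    open UnionBound.APs (suc k) (suc k)
    miss≤p⁻³ : ∀ g d → ProgressionIn N (suc k) g d → prob D (disjointAP g d p) ℚ.≤ ratio 1 (p ^ 3)
    miss≤p⁻³ g d (1≤g , 0<d , last≤N) = ℚ.≤-trans (ℚ.≤-reflexive (D-prob g d 1≤g 0<d last≤N)) q^m≤p⁻³
    d≤p-1 : ∀ g d → ProgressionIn N (suc k) g d → d ≤ suc k
    d≤p-1 g d (1≤g , _ , last≤N) = ≤-pred (d<p 1≤g last≤N)
    few-progressions : (N * suc k) · ratio 1 (p ^ 3) ℚ.< 1ℚ
    few-progressions = subst (ℚ._< 1ℚ) (sym (·-ratio (N * suc k) (pred (p ^ 3))))
                             (ratio<1 (N * suc k) (pred (p ^ 3)) N*[p-1]<p³)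
  ... | x , x∈D , blocks = Colourings.blocking-set⇒<w (proj₁ x) (All.lookup D-free x∈D) blocks W3

open import Data.Nat using (suc; _+_; _*_; _∸_; _^_; _<_; _≤_)
open import Data.Nat.Properties using (*-comm; +-identityʳ)
open import Data.Nat.DivMod using (_/_; m/n*n≤m)
open import Data.Nat.Primality using (¬prime[0]; ¬prime[1])
open import Data.Fin.Subset using (∣_∣)
open import Data.List.Relation.Unary.All using (All)
open import Data.Product using (_,_; proj₁; proj₂; ∃-syntax)
open import Data.Rational using (0ℚ; 1ℚ) renaming (_≤_ to _≤ℚ_; _-_ to _-ℚ_)
open import Relation.Nullary using (contradiction)
open import Relation.Binary.PropositionalEquality using (refl; subst; trans; cong)

lemma4 : ∀ (p m : ℕ) → Prime p → IsR3 (p / 2) m →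
    (∃[ D ] (All (λ x → 0ℚ ≤ℚ proj₂ x) D
             × totalWeight {p * p ∸ p} D ≡ 1ℚ
             × All (λ x → APFree 3 (proj₁ x)) D
             × (∀ g d → 1 ≤ g → 0 < d → g + (p ∸ 1) * d ≤ p * p ∸ p →
                  prob D (disjointAP g d p) ≡ powℚ (1ℚ -ℚ ratio m (p ∸ 1)) m)))
    × (powℚ (1ℚ -ℚ ratio m (p ∸ 1)) m ≤ℚ ratio 1 (p ^ 3) →
         ∀ w → IsW3 p w → p * p ∸ p < w)
lemma4 0 m p-prime _ = contradiction p-prime ¬prime[0]
lemma4 1 m p-prime _ = contradiction p-prime ¬prime[1]
lemma4 p@(suc (suc k)) .(∣ S₀ ∣) p-prime ((S₀ , S₀-free , refl) , _) =
  (D , D-nonneg , D-total , D-free , D-prob) , N<w3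
  where
  halves≤p : p / 2 + p / 2 ≤ p
  halves≤p = subst (_≤ p) (trans (*-comm (p / 2) 2) (cong (p / 2 +_) (+-identityʳ (p / 2)))) (m/n*n≤m p 2)
  open Construction k p-prime halves≤p S₀ S₀-free
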